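{- Let $t\ge2$, $m_1,m_2\ge1$, and let $\lambda,\mu$ be partitions with $\ell(\lambda)\le tm_1$ and $\ell(\mu)\le tm_2$. If $\mu=\lambda'$, then \[n_i(\lambda,tm_1)+n_{t-1-i}(\mu,tm_2)=m_1+m_2\quad\text{for all }0\le i\le t-1.\] Conversely, if $\lambda$ and $\mu$ are both $t$-cores and these equalities hold, then $\mu=\lambda'$.
   Context: $\lambda'$ denotes the conjugate partition. For a partition $\lambda$ with $\ell(\lambda)\le m$, its beta set is $\beta(\lambda,m)=(\lambda_j+m-j)_{j=1}^m$, and $n_i(\lambda,m)$ is the number of entries of $\beta(\lambda,m)$ congruent to $i$ modulo $t$. A $t$-core is a partition with no cell of hook length divisible by $t$. -}

module Defs where

open import Data.Nat using (ℕ; zero; suc; _+_; _∸_; _≤_; _<_; _≥_; NonZero)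
open import Data.Nat.Properties using (_≟_; _≤?_)
open import Data.Nat.DivMod using (_%_)
open import Data.Nat.Divisibility using (_∣_)
open import Data.List using (List; []; _∷_; length; filter; applyUpTo)
open import Data.List.Relation.Unary.All using (All)
open import Data.List.Relation.Unary.Linked using (Linked)
open import Data.Product using (_×_)
open import Relation.Nullary using (¬_)

IsPartition : List ℕ → Set
IsPartition λs = Linked _≥_ λs × All (λ x → 0 < x) λs

ℓ : List ℕ → ℕ
ℓ = length

-- λ_j, 1-indexed, with λ_j = 0 for j > ℓ(λ) (and for j = 0 by convention)
part : List ℕ → ℕ → ℕ
part []       _             = 0
part (x ∷ xs) zero          = 0
part (x ∷ xs) (suc zero)    = x
part (x ∷ xs) (suc (suc j)) = part xs (suc j)

conj : List ℕ → List ℕ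
conj λs = applyUpTo (λ k → length (filter (λ x → suc k ≤? x) λs)) (part λs 1)

beta : List ℕ → ℕ → List ℕ
beta λs m = applyUpTo (λ k → part λs (suc k) + (m ∸ suc k)) m

nCount : (t : ℕ) → .{{_ : NonZero t}} → ℕ → List ℕ → ℕ → ℕ
nCount t i λs m = length (filter (λ x → x % t ≟ i) (beta λs m))

-- hook length of the cell (i,j) (1-indexed, 1 ≤ j ≤ λ_i):
-- h(i,j) = (λ_i - j) + (λ'_j - i) + 1
hook : List ℕ → ℕ → ℕ → ℕ
hook λs i j = suc ((part λs i ∸ j) + (part (conj λs) j ∸ i))

IsCore : ℕ → List ℕ → Set
IsCore t λs = ∀ i j → 1 ≤ i → 1 ≤ j → j ≤ part λs i → ¬ (t ∣ hook λs i j)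

-- For ℓ(λ) ≤ N and λ₁ ≤ M, the beta set β(λ,N) and the reflection y ↦ N+M−1−y of β(λ′,M)
-- partition {0,…,N+M−1}; this follows by induction, adding an empty row or a full first
-- column to λ. When N+M = tK the reflection exchanges the residue classes i and t−1−i mod t,
-- each of which meets {0,…,tK−1} in K points, which gives the counting identity.
-- Conversely, the beta set of a t-core is closed under x ↦ x−t: a gap would, by
-- complementarity, give a cell with hook length t. So on every runner of the t-abacus the
-- beads sit at the top, and the counts n_i determine the beta set. The hypothesis then says
-- that β(μ,M) is the reflected complement of β(λ,N), i.e. β(λ′,M), and beta sets determine
-- partitions.

module Submission where

open import Defs
open import Data.Nat using (ℕ; _+_; _*_; _∸_; _≤_; _<_; NonZero)
open import Data.Product using (_×_)
open import Data.List using (List)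
open import Relation.Binary.PropositionalEquality using (_≡_)

open import Data.Nat
  using (zero; suc; pred; _≥_; s≤s; s≤s⁻¹; z≤n; z<s; s<s; _≟_; _≤?_; _<?_; >-nonZero; >-nonZero⁻¹)
open import Data.Nat.Properties
open import Algebra.Properties.CommutativeSemigroup +-commutativeSemigroup using (interchange)
open import Data.Nat.DivMod
  using ( _%_; _/_; m%n<n; m≡m%n+[m/n]*n; [m+kn]%n≡m%n; m<n⇒m%n≡m; +-distrib-/-∣ʳ; m<n⇒m/n≡0
        ; m*n/n≡m; m<n*o⇒m/o<n; /-monoˡ-≤)
open import Data.Nat.Divisibility using (n∣m*n; ∣-reflexive)
open import Data.Nat.Tactic.RingSolver using (solve-∀)
open import Data.List using ([]; _∷_; length; filter; applyUpTo)
open import Relation.Unary using (Decidable)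
open import Data.List.Properties using (length-applyUpTo)
open import Data.List.Relation.Unary.All using (All; []; _∷_)
open import Data.List.Relation.Unary.All.Properties using (applyUpTo⁺₁)
open import Data.List.Relation.Unary.Linked using (Linked; []; _∷_)
open import Data.Product using (_,_; ∃-syntax; proj₁; proj₂)
open import Function using (_∘_)
open import Relation.Nullary using (Dec; yes; no; contradiction)
open import Relation.Binary.PropositionalEquality
  using (refl; sym; trans; cong; cong₂; subst; _≢_; module ≡-Reasoning)

∑ : ℕ → (ℕ → ℕ) → ℕ
∑ zero    f = 0
∑ (suc n) f = f 0 + ∑ n (f ∘ suc)

∑-cong : ∀ n {f g : ℕ → ℕ} → (∀ k → k < n → f k ≡ g k) → ∑ n f ≡ ∑ n g
∑-cong zero    _   = refl
∑-cong (suc n) f≗g = cong₂ _+_ (f≗g 0 z<s) (∑-cong n (λ k k<n → f≗g (suc k) (s<s k<n)))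

∑-zero : ∀ n {f : ℕ → ℕ} → (∀ k → k < n → f k ≡ 0) → ∑ n f ≡ 0
∑-zero zero    _   = refl
∑-zero (suc n) f≗0 = cong₂ _+_ (f≗0 0 z<s) (∑-zero n (λ k k<n → f≗0 (suc k) (s<s k<n)))

∑-distrib-+ : ∀ n (f g : ℕ → ℕ) → ∑ n (λ k → f k + g k) ≡ ∑ n f + ∑ n g
∑-distrib-+ zero    f g = refl
∑-distrib-+ (suc n) f g =
  trans (cong (f 0 + g 0 +_) (∑-distrib-+ n (f ∘ suc) (g ∘ suc))) (interchange (f 0) (g 0) _ _)

∑-distribʳ-* : ∀ n (f : ℕ → ℕ) c → ∑ n (λ k → f k * c) ≡ ∑ n f * c
∑-distribʳ-* zero    f c = refl
∑-distribʳ-* (suc n) f c =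
  trans (cong (f 0 * c +_) (∑-distribʳ-* n (f ∘ suc) c)) (sym (*-distribʳ-+ c (f 0) _))

∑-split : ∀ m n (f : ℕ → ℕ) → ∑ (m + n) f ≡ ∑ m f + ∑ n (λ k → f (m + k))
∑-split zero    n f = refl
∑-split (suc m) n f = trans (cong (f 0 +_) (∑-split m n (f ∘ suc))) (sym (+-assoc (f 0) _ _))

∑-last : ∀ n (f : ℕ → ℕ) → ∑ (suc n) f ≡ ∑ n f + f n
∑-last zero    f = +-comm (f 0) 0
∑-last (suc n) f = trans (cong (f 0 +_) (∑-last n (f ∘ suc))) (sym (+-assoc (f 0) _ _))

∑-reverse : ∀ n (f : ℕ → ℕ) → ∑ n (λ k → f (n ∸ suc k)) ≡ ∑ n f
∑-reverse zero    f = refl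
∑-reverse (suc n) f =
  trans (cong (f n +_) (∑-reverse n f)) (trans (+-comm (f n) _) (sym (∑-last n f)))

∑-comm : ∀ m n (f : ℕ → ℕ → ℕ) → ∑ m (λ i → ∑ n (f i)) ≡ ∑ n (λ j → ∑ m (λ i → f i j))
∑-comm zero    n f = sym (∑-zero n (λ _ _ → refl))
∑-comm (suc m) n f =
  trans (cong (∑ n (f 0) +_) (∑-comm m n (f ∘ suc))) (sym (∑-distrib-+ n (f 0) _))

∑-blocks : ∀ K t (f : ℕ → ℕ) → ∑ (K * t) f ≡ ∑ K (λ a → ∑ t (λ s → f (a * t + s)))
∑-blocks zero    t f = refl
∑-blocks (suc K) t f = trans (∑-split t (K * t) f) (cong (∑ t f +_)
  (trans (∑-blocks K t (λ k → f (t + k)))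
         (∑-cong K (λ a _ → ∑-cong t (λ s _ → cong f (sym (+-assoc t (a * t) s)))))))

∑-mono-≤ : ∀ n {f g : ℕ → ℕ} → (∀ k → k < n → f k ≤ g k) → ∑ n f ≤ ∑ n g
∑-mono-≤ zero    _   = z≤n
∑-mono-≤ (suc n) f≤g = +-mono-≤ (f≤g 0 z<s) (∑-mono-≤ n (λ k k<n → f≤g (suc k) (s<s k<n)))

∑-prefix : ∀ {m n} (f : ℕ → ℕ) → m ≤ n → ∑ m f ≤ ∑ n f
∑-prefix {m} {n} f m≤n = subst (λ n → ∑ m f ≤ ∑ n f) (m+[n∸m]≡n m≤n)
  (subst (∑ m f ≤_) (sym (∑-split m (n ∸ m) f)) (m≤m+n _ _))

∑-negligible-tail : ∀ {m n} (f : ℕ → ℕ) → m ≤ n → (∀ k → m ≤ k → f k ≡ 0) → ∑ n f ≡ ∑ m f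
∑-negligible-tail {m} {n} f m≤n f≗0 = begin
  ∑ n f                                ≡⟨ cong (λ n → ∑ n f) (m+[n∸m]≡n m≤n) ⟨
  ∑ (m + (n ∸ m)) f                    ≡⟨ ∑-split m (n ∸ m) f ⟩
  ∑ m f + ∑ (n ∸ m) (λ k → f (m + k))  ≡⟨ cong (∑ m f +_) (∑-zero (n ∸ m) (λ k _ → f≗0 (m + k) (m≤m+n m k))) ⟩
  ∑ m f + 0                            ≡⟨ +-identityʳ _ ⟩
  ∑ m f                                ∎
  where open ≡-Reasoning

∑-1 : ∀ n → ∑ n (λ _ → 1) ≡ n
∑-1 zero    = refl
∑-1 (suc n) = cong suc (∑-1 n)

∑-≤-length : ∀ n {f : ℕ → ℕ} → (∀ k → k < n → f k ≤ 1) → ∑ n f ≤ n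
∑-≤-length n f≤1 = subst (∑ n _ ≤_) (∑-1 n) (∑-mono-≤ n f≤1)

f≤∑ : ∀ n (f : ℕ → ℕ) k → k < n → f k ≤ ∑ n f
f≤∑ (suc n) f zero    _         = m≤m+n (f 0) _
f≤∑ (suc n) f (suc k) (s<s k<n) = ≤-trans (f≤∑ n (f ∘ suc) k k<n) (m≤n+m _ (f 0))

∑-positive : ∀ n (f : ℕ → ℕ) → 0 < ∑ n f → ∃[ k ] (k < n × 0 < f k)
∑-positive (suc n) f ∑>0 with f 0 in f0
... | suc _ = 0 , z<s , subst (0 <_) (sym f0) z<s
... | zero with ∑-positive n (f ∘ suc) ∑>0
...   | k , k<n , fk>0 = suc k , s<s k<n , fk>0

⟦_≡_⟧ : ℕ → ℕ → ℕ
⟦ zero  ≡ zero  ⟧ = 1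
⟦ zero  ≡ suc b ⟧ = 0
⟦ suc a ≡ zero  ⟧ = 0
⟦ suc a ≡ suc b ⟧ = ⟦ a ≡ b ⟧

⟦_≤_⟧ : ℕ → ℕ → ℕ
⟦ zero  ≤ a     ⟧ = 1
⟦ suc j ≤ zero  ⟧ = 0
⟦ suc j ≤ suc a ⟧ = ⟦ j ≤ a ⟧

⟦_<_⟧ : ℕ → ℕ → ℕ
⟦ a     < zero  ⟧ = 0
⟦ zero  < suc n ⟧ = 1
⟦ suc a < suc n ⟧ = ⟦ a < n ⟧

⟦≡⟧-refl : ∀ a → ⟦ a ≡ a ⟧ ≡ 1
⟦≡⟧-refl zero    = refl
⟦≡⟧-refl (suc a) = ⟦≡⟧-refl a

⟦≡⟧-≢ : ∀ {a b} → a ≢ b → ⟦ a ≡ b ⟧ ≡ 0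
⟦≡⟧-≢ {zero}  {zero}  a≢b = contradiction refl a≢b
⟦≡⟧-≢ {zero}  {suc b} _   = refl
⟦≡⟧-≢ {suc a} {zero}  _   = refl
⟦≡⟧-≢ {suc a} {suc b} a≢b = ⟦≡⟧-≢ (a≢b ∘ cong suc)

⟦≡⟧⇒≡ : ∀ a b → 0 < ⟦ a ≡ b ⟧ → a ≡ b
⟦≡⟧⇒≡ zero    zero    _ = refl
⟦≡⟧⇒≡ (suc a) (suc b) p = cong suc (⟦≡⟧⇒≡ a b p)

⟦≡⟧-sym : ∀ a b → ⟦ a ≡ b ⟧ ≡ ⟦ b ≡ a ⟧
⟦≡⟧-sym zero    zero    = refl
⟦≡⟧-sym zero    (suc b) = refl
⟦≡⟧-sym (suc a) zero    = refl
⟦≡⟧-sym (suc a) (suc b) = ⟦≡⟧-sym a b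

⟦≤⟧≤1 : ∀ j a → ⟦ j ≤ a ⟧ ≤ 1
⟦≤⟧≤1 zero    a       = ≤-refl
⟦≤⟧≤1 (suc j) zero    = z≤n
⟦≤⟧≤1 (suc j) (suc a) = ⟦≤⟧≤1 j a

⟦≤⟧-yes : ∀ {j a} → j ≤ a → ⟦ j ≤ a ⟧ ≡ 1
⟦≤⟧-yes z≤n       = refl
⟦≤⟧-yes (s≤s j≤a) = ⟦≤⟧-yes j≤a

⟦≤⟧-no : ∀ {j a} → a < j → ⟦ j ≤ a ⟧ ≡ 0
⟦≤⟧-no {suc j} {zero}  _         = refl
⟦≤⟧-no {suc j} {suc a} (s<s a<j) = ⟦≤⟧-no a<j

⟦≤⟧-antitone : ∀ j a → ⟦ suc j ≤ a ⟧ ≤ ⟦ j ≤ a ⟧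
⟦≤⟧-antitone zero    a       = ⟦≤⟧≤1 1 a
⟦≤⟧-antitone (suc j) zero    = z≤n
⟦≤⟧-antitone (suc j) (suc a) = ⟦≤⟧-antitone j a

⟦<⟧-yes : ∀ {a n} → a < n → ⟦ a < n ⟧ ≡ 1
⟦<⟧-yes {zero}  {suc n} _         = refl
⟦<⟧-yes {suc a} {suc n} (s<s a<n) = ⟦<⟧-yes a<n

⟦<⟧-no : ∀ {a n} → n ≤ a → ⟦ a < n ⟧ ≡ 0
⟦<⟧-no {a}     {zero}  _         = refl
⟦<⟧-no {suc a} {suc n} (s≤s n≤a) = ⟦<⟧-no n≤a

⟦<⟧-complement : ∀ n m a b → suc (a + b) ≡ n + m → ⟦ a < n ⟧ + ⟦ b < m ⟧ ≡ 1
⟦<⟧-complement zero    m a       b eq = ⟦<⟧-yes (subst (b <_) eq (s≤s (m≤n+m b a)))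
⟦<⟧-complement (suc n) m zero    b eq = cong suc (⟦<⟧-no (subst (m ≤_) (suc-injective (sym eq)) (m≤n+m m n)))
⟦<⟧-complement (suc n) m (suc a) b eq = ⟦<⟧-complement n m a b (suc-injective eq)

∑-⟦≡⟧ : ∀ n (h : ℕ → ℕ) b → b < n → ∑ n (λ x → ⟦ x ≡ b ⟧ * h x) ≡ h b
∑-⟦≡⟧ (suc n) h zero    _         =
  trans (cong (h 0 + 0 +_) (∑-zero n (λ _ _ → refl))) (trans (+-identityʳ _) (+-identityʳ _))
∑-⟦≡⟧ (suc n) h (suc b) (s<s b<n) = ∑-⟦≡⟧ n (h ∘ suc) b b<n

𝟙 : ∀ {A : Set} → Dec A → ℕ
𝟙 (yes _) = 1
𝟙 (no  _) = 0

𝟙-≟ : ∀ a b → 𝟙 (a ≟ b) ≡ ⟦ a ≡ b ⟧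
𝟙-≟ a b with a ≟ b
... | yes refl = sym (⟦≡⟧-refl a)
... | no  a≢b  = sym (⟦≡⟧-≢ a≢b)

𝟙-≤? : ∀ j a → 𝟙 (j ≤? a) ≡ ⟦ j ≤ a ⟧
𝟙-≤? j a with j ≤? a
... | yes j≤a = sym (⟦≤⟧-yes j≤a)
... | no  j≰a = sym (⟦≤⟧-no (≰⇒> j≰a))

module _ {P : ℕ → Set} (P? : Decidable P) where

  length-filter-∷ : ∀ x xs → length (filter P? (x ∷ xs)) ≡ 𝟙 (P? x) + length (filter P? xs)
  length-filter-∷ x xs with P? x
  ... | yes _ = refl
  ... | no  _ = refl

  length-filter-applyUpTo : ∀ (f : ℕ → ℕ) n →
                            length (filter P? (applyUpTo f n)) ≡ ∑ n (λ k → 𝟙 (P? (f k)))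
  length-filter-applyUpTo f zero    = refl
  length-filter-applyUpTo f (suc n) =
    trans (length-filter-∷ (f 0) _) (cong (𝟙 (P? (f 0)) +_) (length-filter-applyUpTo (f ∘ suc) n))

-- Partitions as part functions

part-applyUpTo : ∀ (f : ℕ → ℕ) n k → k < n → part (applyUpTo f n) (suc k) ≡ f k
part-applyUpTo f (suc n) zero    _         = refl
part-applyUpTo f (suc n) (suc k) (s<s k<n) = part-applyUpTo (f ∘ suc) n k k<n

part-≥length : ∀ L k → length L ≤ k → part L (suc k) ≡ 0
part-≥length []      k       _           = refl
part-≥length (x ∷ L) (suc k) (s≤s ℓL≤k) = part-≥length L k ℓL≤k

part-injective : ∀ L L′ → All (0 <_) L → All (0 <_) L′ →
                 (∀ k → part L (suc k) ≡ part L′ (suc k)) → L ≡ L′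
part-injective []      []        _        _          _  = refl
part-injective []      (y ∷ L′) _        (y>0 ∷ _)  eq = contradiction (eq 0) (<⇒≢ y>0)
part-injective (x ∷ L) []        (x>0 ∷ _) _         eq = contradiction (sym (eq 0)) (<⇒≢ x>0)
part-injective (x ∷ L) (y ∷ L′) (_ ∷ L>0) (_ ∷ L′>0) eq =
  cong₂ _∷_ (eq 0) (part-injective L L′ L>0 L′>0 (eq ∘ suc))

WeaklyDecreasing : (ℕ → ℕ) → Set
WeaklyDecreasing p = ∀ k → p (suc (suc k)) ≤ p (suc k)

part-weaklyDecreasing : ∀ L → Linked _≥_ L → WeaklyDecreasing (part L)
part-weaklyDecreasing []          _           k       = ≤-refl
part-weaklyDecreasing (x ∷ [])    _           zero    = z≤n
part-weaklyDecreasing (x ∷ [])    _           (suc k) = ≤-refl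
part-weaklyDecreasing (x ∷ y ∷ L) (x≥y ∷ _)   zero    = x≥y
part-weaklyDecreasing (x ∷ y ∷ L) (_ ∷ y∷L↓) (suc k) = part-weaklyDecreasing (y ∷ L) y∷L↓ k

weaklyDecreasing-≤ : ∀ p → WeaklyDecreasing p → ∀ {i j} → i ≤ j → p (suc j) ≤ p (suc i)
weaklyDecreasing-≤ p p↓ {j = zero}  z≤n       = ≤-refl
weaklyDecreasing-≤ p p↓ {j = suc j} z≤n       = ≤-trans (p↓ j) (weaklyDecreasing-≤ p p↓ z≤n)
weaklyDecreasing-≤ p p↓             (s≤s i≤j) = weaklyDecreasing-≤ (p ∘ suc) (p↓ ∘ suc) i≤j

part≤part₁ : ∀ L → Linked _≥_ L → ∀ k → part L (suc k) ≤ part L 1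
part≤part₁ L L↓ k = weaklyDecreasing-≤ (part L) (part-weaklyDecreasing L L↓) z≤n

conjugate : (ℕ → ℕ) → ℕ → ℕ → ℕ
conjugate p N j = ∑ N (λ i → ⟦ j ≤ p (suc i) ⟧)

conjugate≤ : ∀ p N j → conjugate p N j ≤ N
conjugate≤ p N j = ∑-≤-length N (λ i _ → ⟦≤⟧≤1 j (p (suc i)))

conjugate-weaklyDecreasing : ∀ p N → WeaklyDecreasing (conjugate p N)
conjugate-weaklyDecreasing p N k = ∑-mono-≤ N (λ i _ → ⟦≤⟧-antitone (suc k) (p (suc i)))

length-filter-≤?≡conjugate : ∀ L N → length L ≤ N → ∀ k →
                  length (filter (suc k ≤?_) L) ≡ conjugate (part L) N (suc k)
length-filter-≤?≡conjugate []      N       _           k = sym (∑-zero N (λ _ _ → refl))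
length-filter-≤?≡conjugate (x ∷ L) (suc N) (s≤s ℓL≤N) k =
  trans (length-filter-∷ (suc k ≤?_) x L)
        (cong₂ _+_ (𝟙-≤? (suc k) x) (length-filter-≤?≡conjugate L N ℓL≤N k))

part-conj : ∀ L N → Linked _≥_ L → length L ≤ N → ∀ k →
            part (conj L) (suc k) ≡ conjugate (part L) N (suc k)
part-conj L N L↓ ℓL≤N k with k <? part L 1
... | yes k<λ₁ = trans (part-applyUpTo _ (part L 1) k k<λ₁) (length-filter-≤?≡conjugate L N ℓL≤N k)
... | no  k≮λ₁ = trans (part-≥length (conj L) k (≤-trans (≤-reflexive (length-applyUpTo _ _)) (≮⇒≥ k≮λ₁)))
  (sym (∑-zero N (λ i _ → ⟦≤⟧-no (s≤s (≤-trans (part≤part₁ L L↓ i) (≮⇒≥ k≮λ₁))))))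

conj-positive : ∀ L → All (0 <_) (conj L)
conj-positive []      = []
conj-positive (x ∷ L) = applyUpTo⁺₁ _ x λ {k} k<x →
  subst (0 <_) (sym (length-filter-∷ (suc k ≤?_) x L))
    (subst (λ c → 0 < c + _) (sym (trans (𝟙-≤? (suc k) x) (⟦≤⟧-yes k<x))) z<s)

≤p⇒<conjugate : ∀ p N → WeaklyDecreasing p → ∀ {k j} → k < N → j ≤ p (suc k) → k < conjugate p N j
≤p⇒<conjugate p N p↓ {k} {j} k<N j≤pk = begin
  suc k                             ≡⟨ ∑-1 (suc k) ⟨
  ∑ (suc k) (λ _ → 1)               ≤⟨ ∑-mono-≤ (suc k) (λ i i≤k → ≤-reflexive (sym (⟦≤⟧-yes
                                         (≤-trans j≤pk (weaklyDecreasing-≤ p p↓ (s≤s⁻¹ i≤k)))))) ⟩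
  ∑ (suc k) (λ i → ⟦ j ≤ p (suc i) ⟧) ≤⟨ ∑-prefix _ k<N ⟩
  conjugate p N j                   ∎
  where open ≤-Reasoning

p<⇒conjugate≤ : ∀ p N → WeaklyDecreasing p → ∀ {k j} → k < N → p (suc k) < j → conjugate p N j ≤ k
p<⇒conjugate≤ p N p↓ {k} {j} k<N pk<j = begin
  conjugate p N j                   ≡⟨ ∑-negligible-tail _ (<⇒≤ k<N) (λ i k≤i →
                                         ⟦≤⟧-no (≤-<-trans (weaklyDecreasing-≤ p p↓ k≤i) pk<j)) ⟩
  ∑ k (λ i → ⟦ j ≤ p (suc i) ⟧)     ≤⟨ ∑-≤-length k (λ i _ → ⟦≤⟧≤1 j (p (suc i))) ⟩
  k                                 ∎
  where open ≤-Reasoning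

-- Beta sets and complementarity

-- β p N k is the entry of β(λ,N) with index k + 1 when p = part λ.
β : (ℕ → ℕ) → ℕ → ℕ → ℕ
β p N k = p (suc k) + (N ∸ suc k)

mult : (ℕ → ℕ) → ℕ → ℕ → ℕ
mult f n x = ∑ n (λ k → ⟦ f k ≡ x ⟧)

β< : ∀ p N M → (∀ k → p (suc k) ≤ M) → ∀ k → k < N → β p N k < N + M
β< p N M p≤M k k<N = subst (β p N k <_) (+-comm M N) (+-mono-≤-< (p≤M k) (∸-monoʳ-< z<s k<N))

β-conjugate< : ∀ p N M k → k < M → β (conjugate p N) M k < N + M
β-conjugate< p N M k k<M =
  subst (β (conjugate p N) M k <_) (+-comm M N) (β< (conjugate p N) M N (λ j → conjugate≤ p N (suc j)) k k<M)

mult-≥ : ∀ (f : ℕ → ℕ) n U → (∀ k → k < n → f k < U) → ∀ x → U ≤ x → mult f n x ≡ 0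
mult-≥ f n U f<U x U≤x = ∑-zero n (λ k k<n → ⟦≡⟧-≢ (<⇒≢ (<-≤-trans (f<U k k<n) U≤x)))

StrictlyDecreasing : (ℕ → ℕ) → ℕ → Set
StrictlyDecreasing c n = ∀ k → suc k < n → c (suc k) < c k

β-strictlyDecreasing : ∀ p N → WeaklyDecreasing p → StrictlyDecreasing (β p N) N
β-strictlyDecreasing p N p↓ k k+1<N = +-mono-≤-< (p↓ k) (∸-monoʳ-< ≤-refl k+1<N)

strictlyDecreasing-tail : ∀ c n → StrictlyDecreasing c (suc n) → StrictlyDecreasing (c ∘ suc) n
strictlyDecreasing-tail c n c↓ k k+1<n = c↓ (suc k) (s<s k+1<n)

strictlyDecreasing-<₀ : ∀ c n → StrictlyDecreasing c n → ∀ k → suc k < n → c (suc k) < c 0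
strictlyDecreasing-<₀ c n c↓ zero    k+1<n = c↓ 0 k+1<n
strictlyDecreasing-<₀ c n c↓ (suc k) k+1<n =
  <-trans (c↓ (suc k) k+1<n) (strictlyDecreasing-<₀ c n c↓ k (<-trans (n<1+n (suc k)) k+1<n))

strictlyDecreasing-≤₀ : ∀ c n → StrictlyDecreasing c n → ∀ k → k < n → c k ≤ c 0
strictlyDecreasing-≤₀ c n c↓ zero    _   = ≤-refl
strictlyDecreasing-≤₀ c n c↓ (suc k) k<n = <⇒≤ (strictlyDecreasing-<₀ c n c↓ k k<n)

mult≤1 : ∀ c n → StrictlyDecreasing c n → ∀ x → mult c n x ≤ 1
mult≤1 c zero    c↓ x = z≤n
mult≤1 c (suc n) c↓ x with c 0 ≟ x
... | yes refl = ≤-reflexive (cong₂ _+_ (⟦≡⟧-refl (c 0))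
      (∑-zero n (λ k k<n → ⟦≡⟧-≢ (<⇒≢ (strictlyDecreasing-<₀ c (suc n) c↓ k (s<s k<n))))))
... | no  c₀≢x = subst (_≤ 1) (cong (_+ mult (c ∘ suc) n x) (sym (⟦≡⟧-≢ c₀≢x)))
      (mult≤1 (c ∘ suc) n (strictlyDecreasing-tail c n c↓) x)

mult-positive : ∀ c n x → 0 < mult c n x → ∃[ k ] (k < n × c k ≡ x)
mult-positive c n x mult>0 with ∑-positive n (λ k → ⟦ c k ≡ x ⟧) mult>0
... | k , k<n , ck≡x = k , k<n , ⟦≡⟧⇒≡ (c k) x ck≡x

mult-self : ∀ c n k → k < n → 0 < mult c n (c k)
mult-self c n k k<n = <-≤-trans (subst (0 <_) (sym (⟦≡⟧-refl (c k))) z<s) (f≤∑ n (λ i → ⟦ c i ≡ c k ⟧) k k<n)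

mult-injective : ∀ c c′ n → StrictlyDecreasing c n → StrictlyDecreasing c′ n →
                 (∀ x → mult c n x ≡ mult c′ n x) → ∀ k → k < n → c k ≡ c′ k
mult-injective c c′ (suc n) c↓ c′↓ same zero    _         =
  ≤-antisym (max≤ c c′ c′↓ same) (max≤ c′ c c↓ (sym ∘ same))
  where
  max≤ : ∀ c c′ → StrictlyDecreasing c′ (suc n) → (∀ x → mult c (suc n) x ≡ mult c′ (suc n) x) →
         c 0 ≤ c′ 0
  max≤ c c′ c′↓ same with mult-positive c′ (suc n) (c 0) (subst (0 <_) (same (c 0)) (mult-self c (suc n) 0 z<s))
  ... | k , k<n , c′k≡c₀ = subst (_≤ c′ 0) c′k≡c₀ (strictlyDecreasing-≤₀ c′ (suc n) c′↓ k k<n)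
mult-injective c c′ (suc n) c↓ c′↓ same (suc k) (s<s k<n) =
  mult-injective (c ∘ suc) (c′ ∘ suc) n (strictlyDecreasing-tail c n c↓) (strictlyDecreasing-tail c′ n c′↓)
    sameTail k k<n
  where
  c₀≡c′₀ : c 0 ≡ c′ 0
  c₀≡c′₀ = mult-injective c c′ (suc n) c↓ c′↓ same 0 z<s
  sameTail : ∀ x → mult (c ∘ suc) n x ≡ mult (c′ ∘ suc) n x
  sameTail x = +-cancelˡ-≡ ⟦ c 0 ≡ x ⟧ _ _
    (trans (same x) (cong (λ z → ⟦ z ≡ x ⟧ + mult (c′ ∘ suc) n x) (sym c₀≡c′₀)))

hook-arith : ∀ {P q i j g t N} → j ≤ P → i ≤ q → P + N ≡ g + t + i → suc (g + q) ≡ N + j →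
             suc ((P ∸ j) + (q ∸ i)) ≡ t
hook-arith {P} {q} {i} {j} {g} {t} {N} j≤P i≤q e₁ e₂ = +-cancelʳ-≡ (g + i + N + j) _ _ (begin
  suc (u + v) + (g + i + N + j)   ≡⟨ regroupˡ u v i j g N ⟩
  (u + j + N) + suc (g + (v + i)) ≡⟨ cong₂ (λ a b → a + N + suc (g + b)) (m∸n+n≡m j≤P) (m∸n+n≡m i≤q) ⟩
  (P + N) + suc (g + q)           ≡⟨ cong₂ _+_ e₁ e₂ ⟩
  (g + t + i) + (N + j)           ≡⟨ regroupʳ t i j g N ⟩
  t + (g + i + N + j)             ∎)
  where
  open ≡-Reasoning
  u = P ∸ j
  v = q ∸ i
  regroupˡ : ∀ u v i j g N → suc (u + v) + (g + i + N + j) ≡ (u + j + N) + suc (g + (v + i))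
  regroupˡ = solve-∀
  regroupʳ : ∀ t i j g N → (g + t + i) + (N + j) ≡ t + (g + i + N + j)
  regroupʳ = solve-∀

-- Stated for pairs with x + y = N + M − 1, so that no truncated subtraction occurs.
Complementary : ℕ → ℕ → (ℕ → ℕ) → Set
Complementary N M p = ∀ x y → suc (x + y) ≡ N + M →
  mult (β p N) N x + mult (β (conjugate p N) M) M y ≡ 1

complementary-noRows : ∀ M p → Complementary 0 M p
complementary-noRows M p x y eq = begin
  ∑ M (λ k → ⟦ M ∸ suc k ≡ y ⟧) ≡⟨ ∑-reverse M (λ k → ⟦ k ≡ y ⟧) ⟩
  ∑ M (λ k → ⟦ k ≡ y ⟧)         ≡⟨ ∑-cong M (λ k _ → *-identityʳ _) ⟨
  ∑ M (λ k → ⟦ k ≡ y ⟧ * 1)     ≡⟨ ∑-⟦≡⟧ M (λ _ → 1) y (subst (y <_) eq (s≤s (m≤n+m y x))) ⟩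
  1                             ∎
  where open ≡-Reasoning

complementary-addEmptyRow : ∀ N M p → p (suc N) ≡ 0 → Complementary N M p → Complementary (suc N) M p
complementary-addEmptyRow N M p pN≡0 comp x y eq = begin
  mult (β p (suc N)) (suc N) x + mult (β (conjugate p (suc N)) M) M y
    ≡⟨ cong₂ _+_ multβ (∑-cong M (λ k _ → cong (λ c → ⟦ c + (M ∸ suc k) ≡ y ⟧) (conjugate-eq k))) ⟩
  mult (suc ∘ β p N) N x + ⟦ 0 ≡ x ⟧ + mult (β (conjugate p N) M) M y
    ≡⟨ shift x eq ⟩
  1 ∎
  where
  open ≡-Reasoning
  multβ : mult (β p (suc N)) (suc N) x ≡ mult (suc ∘ β p N) N x + ⟦ 0 ≡ x ⟧
  multβ = trans (∑-last N _) (cong₂ _+_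
    (∑-cong N (λ k k<N → cong ⟦_≡ x ⟧ (trans (cong (p (suc k) +_) (+-∸-assoc 1 k<N)) (+-suc _ _))))
    (cong ⟦_≡ x ⟧ (cong₂ _+_ pN≡0 (n∸n≡0 N))))
  conjugate-eq : ∀ k → conjugate p (suc N) (suc k) ≡ conjugate p N (suc k)
  conjugate-eq k = trans (∑-last N (λ i → ⟦ suc k ≤ p (suc i) ⟧))
    (trans (cong (conjugate p N (suc k) +_) (cong ⟦ suc k ≤_⟧ pN≡0)) (+-identityʳ _))
  shift : ∀ x → suc (x + y) ≡ suc N + M →
          mult (suc ∘ β p N) N x + ⟦ 0 ≡ x ⟧ + mult (β (conjugate p N) M) M y ≡ 1
  shift zero    eq = cong₂ _+_ (cong (_+ 1) (∑-zero N (λ _ _ → refl)))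
    (mult-≥ (β (conjugate p N) M) M (N + M) (β-conjugate< p N M)
            y (≤-reflexive (sym (suc-injective eq))))
  shift (suc x) eq = trans (cong (_+ mult (β (conjugate p N) M) M y) (+-identityʳ _)) (comp x y (suc-injective eq))

⟦suc≤⟧-pred : ∀ j c → ⟦ suc (suc j) ≤ c ⟧ ≡ ⟦ suc j ≤ pred c ⟧
⟦suc≤⟧-pred j zero    = refl
⟦suc≤⟧-pred j (suc c) = refl

complementary-addColumn : ∀ N M p → (∀ k → k < suc N → 0 < p (suc k)) →
                          Complementary (suc N) M (pred ∘ p) → Complementary (suc N) (suc M) p
complementary-addColumn N M p p>0 comp x y eq = begin
  mult (β p (suc N)) (suc N) x + mult (β (conjugate p (suc N)) (suc M)) (suc M) y
    ≡⟨ cong₂ _+_ multβ multβ′ ⟩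
  mult (suc ∘ β p⁻ (suc N)) (suc N) x + (⟦ suc N + M ≡ y ⟧ + mult (β (conjugate p⁻ (suc N)) M) M y)
    ≡⟨ shift x eq ⟩
  1 ∎
  where
  open ≡-Reasoning
  p⁻ : ℕ → ℕ
  p⁻ = pred ∘ p
  p≡suc : ∀ k → k < suc N → p (suc k) ≡ suc (p⁻ (suc k))
  p≡suc k k<sN = sym (suc-pred _ {{>-nonZero (p>0 k k<sN)}})
  multβ : mult (β p (suc N)) (suc N) x ≡ mult (suc ∘ β p⁻ (suc N)) (suc N) x
  multβ = ∑-cong (suc N) (λ k k<sN → cong (λ c → ⟦ c + (suc N ∸ suc k) ≡ x ⟧) (p≡suc k k<sN))
  conjugate-1 : conjugate p (suc N) 1 ≡ suc N
  conjugate-1 = trans (∑-cong (suc N) (λ k k<sN → cong ⟦ 1 ≤_⟧ (p≡suc k k<sN))) (∑-1 (suc N))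
  multβ′ : mult (β (conjugate p (suc N)) (suc M)) (suc M) y ≡
           ⟦ suc N + M ≡ y ⟧ + mult (β (conjugate p⁻ (suc N)) M) M y
  multβ′ = cong₂ _+_ (cong (λ c → ⟦ c + M ≡ y ⟧) conjugate-1) (∑-cong M (λ k _ →
    cong (λ c → ⟦ c + (M ∸ suc k) ≡ y ⟧) (∑-cong (suc N) (λ i _ → ⟦suc≤⟧-pred k (p (suc i))))))
  shift : ∀ x → suc (x + y) ≡ suc N + suc M →
          mult (suc ∘ β p⁻ (suc N)) (suc N) x + (⟦ suc N + M ≡ y ⟧ + mult (β (conjugate p⁻ (suc N)) M) M y)
            ≡ 1
  shift zero    eq = cong₂ _+_ (∑-zero (suc N) (λ _ _ → refl)) (cong₂ _+_
    (trans (cong ⟦ suc N + M ≡_⟧ y≡) (⟦≡⟧-refl (suc N + M)))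
    (mult-≥ (β (conjugate p⁻ (suc N)) M) M (suc N + M) (β-conjugate< p⁻ (suc N) M) y (≤-reflexive (sym y≡))))
    where
    y≡ : y ≡ suc N + M
    y≡ = trans (suc-injective eq) (+-suc N M)
  shift (suc x) eq = trans
    (cong (λ c → mult (β p⁻ (suc N)) (suc N) x + (c + mult (β (conjugate p⁻ (suc N)) M) M y))
          (⟦≡⟧-≢ (>⇒≢ y<)))
    (comp x y eq′)
    where
    eq′ : suc (x + y) ≡ suc N + M
    eq′ = suc-injective (trans eq (cong suc (+-suc N M)))
    y< : y < suc N + M
    y< = subst (y <_) eq′ (s≤s (m≤n+m y x))

β-conjugate-complementary : ∀ N M p → WeaklyDecreasing p → (∀ k → p (suc k) ≤ M) → Complementary N M p
β-conjugate-complementary zero    M p p↓ p≤M = complementary-noRows M p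
β-conjugate-complementary (suc N) M p p↓ p≤M with p (suc N) in pN
... | zero = complementary-addEmptyRow N M p pN (β-conjugate-complementary N M p p↓ p≤M)
β-conjugate-complementary (suc N) zero    p p↓ p≤M | suc _ = contradiction (subst (_≤ 0) pN (p≤M N)) λ ()
β-conjugate-complementary (suc N) (suc M) p p↓ p≤M | suc _ =
  complementary-addColumn N M p
    (λ k k<sN → <-≤-trans (subst (0 <_) (sym pN) z<s) (weaklyDecreasing-≤ p p↓ (s≤s⁻¹ k<sN)))
    (β-conjugate-complementary (suc N) M (pred ∘ p) (pred-mono-≤ ∘ p↓) (pred-mono-≤ ∘ p≤M))

-- Residues modulo t

⟦≡⟧-complement : ∀ a b c d → a + b ≡ c + d → ⟦ a ≡ c ⟧ ≡ ⟦ b ≡ d ⟧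
⟦≡⟧-complement a b c d eq with a ≟ c
... | yes refl = trans (⟦≡⟧-refl a) (sym (trans (cong ⟦ b ≡_⟧ (sym (+-cancelˡ-≡ a b d eq))) (⟦≡⟧-refl b)))
... | no  a≢c  = trans (⟦≡⟧-≢ a≢c) (sym (⟦≡⟧-≢ {b} {d} λ { refl → a≢c (+-cancelʳ-≡ b a c eq) }))

%-+* : ∀ t .{{_ : NonZero t}} r a → r < t → (r + a * t) % t ≡ r
%-+* t r a r<t = trans ([m+kn]%n≡m%n r a t) (m<n⇒m%n≡m r<t)

/-+* : ∀ t .{{_ : NonZero t}} r a → r < t → (r + a * t) / t ≡ a
/-+* t r a r<t = trans (+-distrib-/-∣ʳ r (n∣m*n a)) (cong₂ _+_ (m<n⇒m/n≡0 r<t) (m*n/n≡m a t))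

divMod-complement : ∀ t .{{_ : NonZero t}} K x y → suc (x + y) ≡ t * K →
                    suc (x % t + y % t) ≡ t × suc (x / t + y / t) ≡ K
divMod-complement t K x y eq =
  subst (λ y → suc (r + y % t) ≡ t × suc (a + y / t) ≡ K) (sym y≡)
    ( trans (cong (λ z → suc (r + z)) (%-+* t e d e<t)) (m+[n∸m]≡n r<t)
    , trans (cong (λ z → suc (a + z)) (/-+* t e d e<t)) (m+[n∸m]≡n a<K))
  where
  r a e d : ℕ
  r = x % t
  a = x / t
  e = t ∸ suc r
  d = K ∸ suc a
  r<t : r < t
  r<t = m%n<n x t
  a<K : a < K
  a<K = m<n*o⇒m/o<n (subst (x <_) (trans eq (*-comm t K)) (s≤s (m≤m+n x y)))
  e<t : e < t
  e<t = ∸-monoʳ-< z<s r<t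
  y≡ : y ≡ e + d * t
  y≡ = +-cancelˡ-≡ x _ _ (suc-injective (begin
    suc (x + y)                   ≡⟨ eq ⟩
    t * K                         ≡⟨ *-comm t K ⟩
    K * t                         ≡⟨ cong (_* t) (m+[n∸m]≡n a<K) ⟨
    (suc a + d) * t               ≡⟨ cong (_+ (a + d) * t) (m+[n∸m]≡n r<t) ⟨
    suc r + e + (a + d) * t       ≡⟨ regroup r e a d t ⟩
    suc (r + a * t + (e + d * t)) ≡⟨ cong (λ z → suc (z + (e + d * t))) (m≡m%n+[m/n]*n x t) ⟨
    suc (x + (e + d * t))         ∎))
    where
    open ≡-Reasoning
    regroup : ∀ r e a d t → suc r + e + (a + d) * t ≡ suc (r + a * t + (e + d * t))
    regroup = solve-∀

∑-residueClass : ∀ t .{{_ : NonZero t}} W r → r < t → (h : ℕ → ℕ) →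
                 ∑ (W * t) (λ x → ⟦ x % t ≡ r ⟧ * h x) ≡ ∑ W (λ a → h (a * t + r))
∑-residueClass t W r r<t h = trans (∑-blocks W t _) (∑-cong W (λ a _ → trans
  (∑-cong t (λ s s<t → cong (λ c → ⟦ c ≡ r ⟧ * h (a * t + s)) (residue a s s<t)))
  (∑-⟦≡⟧ t (λ s → h (a * t + s)) r r<t)))
  where
  residue : ∀ a s → s < t → (a * t + s) % t ≡ s
  residue a s s<t = trans (cong (_% t) (+-comm (a * t) s)) (%-+* t s a s<t)

∑-mult : ∀ n (f : ℕ → ℕ) U (h : ℕ → ℕ) → (∀ k → k < n → f k < U) →
         ∑ n (h ∘ f) ≡ ∑ U (λ x → mult f n x * h x)
∑-mult n f U h f<U = begin
  ∑ n (h ∘ f)                                   ≡⟨ ∑-cong n (λ k k<n → ∑-⟦≡⟧ U h (f k) (f<U k k<n)) ⟨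
  ∑ n (λ k → ∑ U (λ x → ⟦ x ≡ f k ⟧ * h x))     ≡⟨ ∑-comm n U _ ⟩
  ∑ U (λ x → ∑ n (λ k → ⟦ x ≡ f k ⟧ * h x))     ≡⟨ ∑-cong U (λ x _ → ∑-cong n (λ k _ →
                                                     cong (_* h x) (⟦≡⟧-sym x (f k)))) ⟩
  ∑ U (λ x → ∑ n (λ k → ⟦ f k ≡ x ⟧ * h x))     ≡⟨ ∑-cong U (λ x _ → ∑-distribʳ-* n _ (h x)) ⟩
  ∑ U (λ x → mult f n x * h x)                  ∎
  where open ≡-Reasoning

residueCount : (t : ℕ) → .{{NonZero t}} → (ℕ → ℕ) → ℕ → ℕ → ℕ
residueCount t p N r = ∑ N (λ k → ⟦ β p N k % t ≡ r ⟧)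

nCount≡residueCount : ∀ t .{{_ : NonZero t}} r L N → nCount t r L N ≡ residueCount t (part L) N r
nCount≡residueCount t r L N =
  trans (length-filter-applyUpTo (λ x → x % t ≟ r) (β (part L) N) N) (∑-cong N (λ k _ → 𝟙-≟ _ r))

count-residueClass : ∀ t .{{_ : NonZero t}} W r → r < t → ∑ (W * t) (λ x → ⟦ x % t ≡ r ⟧) ≡ W
count-residueClass t W r r<t = trans (∑-cong (W * t) (λ _ _ → sym (*-identityʳ _)))
  (trans (∑-residueClass t W r r<t (λ _ → 1)) (∑-1 W))

residueCount-complement : ∀ t .{{_ : NonZero t}} K N M p → N + M ≡ t * K →
  WeaklyDecreasing p → (∀ k → p (suc k) ≤ M) → ∀ r r′ → suc (r + r′) ≡ t →
  residueCount t p N r + residueCount t (conjugate p N) M r′ ≡ K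
residueCount-complement t K N M p N+M≡tK p↓ p≤M r r′ r+r′ = begin
  ∑ N (χ ∘ B) + ∑ M (χ′ ∘ C)
    ≡⟨ cong₂ _+_ (∑-mult N B U χ (β< p N M p≤M)) (∑-mult M C U χ′ (β-conjugate< p N M)) ⟩
  ∑ U (λ x → mult B N x * χ x) + ∑ U (λ y → mult C M y * χ′ y)
    ≡⟨ cong (∑ U (λ x → mult B N x * χ x) +_) (∑-reverse U (λ y → mult C M y * χ′ y)) ⟨
  ∑ U (λ x → mult B N x * χ x) + ∑ U (λ x → mult C M (x̄ x) * χ′ (x̄ x))
    ≡⟨ ∑-distrib-+ U _ _ ⟨
  ∑ U (λ x → mult B N x * χ x + mult C M (x̄ x) * χ′ (x̄ x))
    ≡⟨ ∑-cong U complementaryPair ⟩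
  ∑ U χ
    ≡⟨ cong (λ n → ∑ n χ) (trans N+M≡tK (*-comm t K)) ⟩
  ∑ (K * t) χ
    ≡⟨ count-residueClass t K r (subst (r <_) r+r′ (s≤s (m≤m+n r r′))) ⟩
  K ∎
  where
  open ≡-Reasoning
  U = N + M
  B = β p N
  C = β (conjugate p N) M
  χ χ′ x̄ : ℕ → ℕ
  χ  x = ⟦ x % t ≡ r ⟧
  χ′ y = ⟦ y % t ≡ r′ ⟧
  x̄ x = U ∸ suc x
  complementaryPair : ∀ x → x < U → mult B N x * χ x + mult C M (x̄ x) * χ′ (x̄ x) ≡ χ x
  complementaryPair x x<U = begin
    mult B N x * χ x + mult C M (x̄ x) * χ′ (x̄ x)
      ≡⟨ cong (λ c → mult B N x * χ x + mult C M (x̄ x) * c) χ′x̄≡χx ⟩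
    mult B N x * χ x + mult C M (x̄ x) * χ x
      ≡⟨ *-distribʳ-+ (χ x) (mult B N x) _ ⟨
    (mult B N x + mult C M (x̄ x)) * χ x
      ≡⟨ cong (_* χ x) (β-conjugate-complementary N M p p↓ p≤M x (x̄ x) x+x̄) ⟩
    1 * χ x
      ≡⟨ *-identityˡ (χ x) ⟩
    χ x ∎
    where
    x+x̄ : suc (x + x̄ x) ≡ U
    x+x̄ = m+[n∸m]≡n x<U
    χ′x̄≡χx : χ′ (x̄ x) ≡ χ x
    χ′x̄≡χx = sym (⟦≡⟧-complement (x % t) (x̄ x % t) r r′ (suc-injective
      (trans (proj₁ (divMod-complement t K x (x̄ x) (trans x+x̄ N+M≡tK))) (sym r+r′))))

suc-+-∸-suc : ∀ {r t} → r < t → suc (r + (t ∸ 1 ∸ r)) ≡ t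
suc-+-∸-suc {r} {t} r<t = trans (cong (λ s → suc (r + s)) (∸-+-assoc t 1 r)) (m+[n∸m]≡n r<t)

conj-nCount-complement : ∀ t .{{_ : NonZero t}} K N M L → N + M ≡ t * K → Linked _≥_ L →
  length L ≤ N → length (conj L) ≤ M →
  ∀ r → r < t → nCount t r L N + nCount t (t ∸ 1 ∸ r) (conj L) M ≡ K
conj-nCount-complement t K N M L N+M≡tK L↓ ℓL≤N λ₁≤M r r<t = begin
  nCount t r L N + nCount t (t ∸ 1 ∸ r) (conj L) M
    ≡⟨ cong₂ _+_ (nCount≡residueCount t r L N) (nCount≡residueCount t (t ∸ 1 ∸ r) (conj L) M) ⟩
  residueCount t p N r + residueCount t (part (conj L)) M (t ∸ 1 ∸ r)
    ≡⟨ cong (residueCount t p N r +_) (∑-cong M (λ k _ →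
         cong (λ c → ⟦ (c + (M ∸ suc k)) % t ≡ t ∸ 1 ∸ r ⟧) (part-conj L N L↓ ℓL≤N k))) ⟩
  residueCount t p N r + residueCount t (conjugate p N) M (t ∸ 1 ∸ r)
    ≡⟨ residueCount-complement t K N M p N+M≡tK p↓ p≤M r (t ∸ 1 ∸ r) (suc-+-∸-suc r<t) ⟩
  K ∎
  where
  open ≡-Reasoning
  p = part L
  p↓ = part-weaklyDecreasing L L↓
  p≤M : ∀ k → p (suc k) ≤ M
  p≤M k = ≤-trans (part≤part₁ L L↓ k) (subst (_≤ M) (length-applyUpTo _ (p 1)) λ₁≤M)

-- t-cores and the abacus

-- The cell (k+1, k′+1) has hook length β p N k − (N+M−1 − β (conjugate p N) M k′).
β-gap-hook : ∀ p N M → WeaklyDecreasing p → ∀ {k k′ g t} → k < N → k′ < M →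
  g + t ≡ β p N k → suc (g + β (conjugate p N) M k′) ≡ N + M →
  suc k′ ≤ p (suc k) × suc ((p (suc k) ∸ suc k′) + (conjugate p N (suc k′) ∸ suc k)) ≡ t
β-gap-hook p N M p↓ {k} {k′} {g} {t} k<N k′<M gap pair = j≤P , hook-arith j≤P i≤q e₁ e₂
  where
  P = p (suc k)
  q = conjugate p N (suc k′)
  e₁ : P + N ≡ g + t + suc k
  e₁ = trans (cong (P +_) (sym (m∸n+n≡m k<N))) (trans (sym (+-assoc P _ (suc k))) (cong (_+ suc k) (sym gap)))
  e₂ : suc (g + q) ≡ N + suc k′
  e₂ = +-cancelʳ-≡ (M ∸ suc k′) _ _ (begin
    suc (g + q) + (M ∸ suc k′)     ≡⟨ cong suc (+-assoc g q _) ⟩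
    suc (g + (q + (M ∸ suc k′)))   ≡⟨ pair ⟩
    N + M                          ≡⟨ cong (N +_) (m+[n∸m]≡n k′<M) ⟨
    N + (suc k′ + (M ∸ suc k′))    ≡⟨ +-assoc N (suc k′) _ ⟨
    N + suc k′ + (M ∸ suc k′)      ∎)
    where open ≡-Reasoning
  j≤P : suc k′ ≤ P
  j≤P with suc k′ ≤? P
  ... | yes j≤P = j≤P
  ... | no  j≰P = contradiction (begin-strict
      P + N                 <⟨ +-monoˡ-< N (≰⇒> j≰P) ⟩
      suc k′ + N            ≡⟨ trans (+-comm (suc k′) N) (sym e₂) ⟩
      suc (g + q)           ≤⟨ s≤s (+-monoʳ-≤ g (p<⇒conjugate≤ p N p↓ k<N (≰⇒> j≰P))) ⟩
      suc (g + k)           ≡⟨ +-suc g k ⟨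
      g + suc k             ≤⟨ +-monoˡ-≤ (suc k) (m≤m+n g t) ⟩
      g + t + suc k         ≡⟨ e₁ ⟨
      P + N                 ∎) (<-irrefl refl)
    where open ≤-Reasoning
  i≤q : suc k ≤ q
  i≤q = ≤p⇒<conjugate p N p↓ k<N j≤P

core-β-downClosed : ∀ t L N → Linked _≥_ L → length L ≤ N → IsCore t L →
  ∀ x → 0 < mult (β (part L) N) N x → t ≤ x → 0 < mult (β (part L) N) N (x ∸ t)
core-β-downClosed t L N L↓ ℓL≤N core x x∈B t≤x = n≢0⇒n>0 g∈B
  where
  p = part L
  p↓ = part-weaklyDecreasing L L↓
  M = p 1
  g = x ∸ t
  y = N + M ∸ suc g
  g<N+M : g < N + M
  g<N+M with mult-positive (β p N) N x x∈B
  ... | k , k<N , Bk≡x = ≤-<-trans (m∸n≤m x t) (subst (_< N + M) Bk≡x (β< p N M (part≤part₁ L L↓) k k<N))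
  g+y : suc (g + y) ≡ N + M
  g+y = m+[n∸m]≡n g<N+M
  y∈C : mult (β p N) N g ≡ 0 → 0 < mult (β (conjugate p N) M) M y
  y∈C g∉B = subst (0 <_) (trans (sym (β-conjugate-complementary N M p p↓ (part≤part₁ L L↓) g y g+y))
                                (cong (_+ mult (β (conjugate p N) M) M y) g∉B)) z<s
  g∈B : mult (β p N) N g ≢ 0
  g∈B g∉B with mult-positive (β p N) N x x∈B | mult-positive (β (conjugate p N) M) M y (y∈C g∉B)
  ... | k , k<N , Bk≡x | k′ , k′<M , Ck′≡y =
    core (suc k) (suc k′) (s≤s z≤n) (s≤s z≤n) (proj₁ gap) (∣-reflexive (sym hook≡t))
    where
    gap = β-gap-hook p N M p↓ k<N k′<M (trans (m∸n+n≡m t≤x) (sym Bk≡x))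
                                       (trans (cong (λ z → suc (g + z)) Ck′≡y) g+y)
    hook≡t : hook L (suc k) (suc k′) ≡ t
    hook≡t = trans (cong (λ c → suc ((p (suc k) ∸ suc k′) + (c ∸ suc k))) (part-conj L N L↓ ℓL≤N k′))
                   (proj₂ gap)

downClosed-indicator : ∀ B (g : ℕ → ℕ) → (∀ a → g a ≤ 1) → (∀ a → 0 < g (suc a) → 0 < g a) →
                       (∀ a → B ≤ a → g a ≡ 0) → ∀ a → g a ≡ ⟦ a < ∑ B g ⟧
downClosed-indicator zero    g g≤1 g↓ g≥B≡0 a = g≥B≡0 a z≤n
downClosed-indicator (suc B) g g≤1 g↓ g≥B≡0 a with g 0 in g₀
... | zero = trans (allZero a) (sym (cong ⟦ a <_⟧ (∑-zero B (λ k _ → allZero (suc k)))))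
  where
  allZero : ∀ a → g a ≡ 0
  allZero zero    = g₀
  allZero (suc a) = n≤0⇒n≡0 (≮⇒≥ (λ g>0 → <⇒≢ (g↓ a g>0) (sym (allZero a))))
... | suc c = shift a
  where
  c≡0 : c ≡ 0
  c≡0 = n≤0⇒n≡0 (s≤s⁻¹ (subst (_≤ 1) g₀ (g≤1 0)))
  shift : ∀ a → g a ≡ ⟦ a < suc (c + ∑ B (g ∘ suc)) ⟧
  shift zero    = trans g₀ (cong suc c≡0)
  shift (suc a) = trans
    (downClosed-indicator B (g ∘ suc) (g≤1 ∘ suc) (g↓ ∘ suc) (λ a B≤a → g≥B≡0 (suc a) (s≤s B≤a)) a)
    (cong (λ c → ⟦ a < c + ∑ B (g ∘ suc) ⟧) (sym c≡0))

core-mult : ∀ t .{{_ : NonZero t}} L N → Linked _≥_ L → length L ≤ N → IsCore t L → ∀ x →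
            mult (β (part L) N) N x ≡ ⟦ x / t < residueCount t (part L) N (x % t) ⟧
core-mult t L N L↓ ℓL≤N core x = begin
  mult B N x
    ≡⟨ cong (mult B N) (trans (m≡m%n+[m/n]*n x t) (+-comm (x % t) _)) ⟩
  runner (x % t) (x / t)
    ≡⟨ downClosed-indicator W (runner (x % t)) (λ a → mult≤1 B N (β-strictlyDecreasing p N p↓) _)
                            (runner-downClosed (x % t)) (runner-vanishes (x % t)) (x / t) ⟩
  ⟦ x / t < ∑ W (runner (x % t)) ⟧
    ≡⟨ cong ⟦ x / t <_⟧ (residueCount≡∑runner (x % t) (m%n<n x t)) ⟨
  ⟦ x / t < residueCount t p N (x % t) ⟧ ∎
  where
  open ≡-Reasoning
  p = part L
  p↓ = part-weaklyDecreasing L L↓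
  B = β p N
  W = N + p 1
  B<W : ∀ k → k < N → B k < W
  B<W = β< p N (p 1) (part≤part₁ L L↓)
  -- Whether position a t + r, the a-th slot of runner r of the t-abacus, carries a bead.
  runner : ℕ → ℕ → ℕ
  runner r a = mult B N (a * t + r)
  runner-downClosed : ∀ r a → 0 < runner r (suc a) → 0 < runner r a
  runner-downClosed r a a+1∈B =
    subst (λ z → 0 < mult B N z) (trans (cong (_∸ t) (+-assoc t (a * t) r)) (m+n∸m≡n t _))
      (core-β-downClosed t L N L↓ ℓL≤N core (suc a * t + r) a+1∈B (≤-trans (m≤m+n t (a * t)) (m≤m+n _ r)))
  runner-vanishes : ∀ r a → W ≤ a → runner r a ≡ 0
  runner-vanishes r a W≤a = mult-≥ B N W B<W (a * t + r) (≤-trans W≤a (≤-trans (m≤m*n a t) (m≤m+n _ r)))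
  residueCount≡∑runner : ∀ r → r < t → residueCount t p N r ≡ ∑ W (runner r)
  residueCount≡∑runner r r<t = begin
    ∑ N (λ k → ⟦ B k % t ≡ r ⟧)
      ≡⟨ ∑-mult N B (W * t) (λ x → ⟦ x % t ≡ r ⟧) (λ k k<N → <-≤-trans (B<W k k<N) (m≤m*n W t)) ⟩
    ∑ (W * t) (λ x → mult B N x * ⟦ x % t ≡ r ⟧)
      ≡⟨ ∑-cong (W * t) (λ x _ → *-comm (mult B N x) _) ⟩
    ∑ (W * t) (λ x → ⟦ x % t ≡ r ⟧ * mult B N x)
      ≡⟨ ∑-residueClass t W r r<t (mult B N) ⟩
    ∑ W (runner r) ∎

complement-unique : ∀ U (f g h : ℕ → ℕ) → (∀ x y → suc (x + y) ≡ U → f x + g y ≡ 1) →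
                    (∀ x y → suc (x + y) ≡ U → f x + h y ≡ 1) →
                    (∀ y → U ≤ y → g y ≡ 0) → (∀ y → U ≤ y → h y ≡ 0) → ∀ y → g y ≡ h y
complement-unique U f g h f+g f+h g≥U h≥U y with y <? U
... | no  y≮U = trans (g≥U y (≮⇒≥ y≮U)) (sym (h≥U y (≮⇒≥ y≮U)))
... | yes y<U = +-cancelˡ-≡ (f x) _ _ (trans (f+g x y x+y) (sym (f+h x y x+y)))
  where
  x = U ∸ suc y
  x+y : suc (x + y) ≡ U
  x+y = trans (cong suc (+-comm x y)) (m+[n∸m]≡n y<U)

abacus-vanishes : ∀ t .{{_ : NonZero t}} K (n : ℕ → ℕ) → (∀ r → r < t → n r ≤ K) →
                  ∀ x → t * K ≤ x → ⟦ x / t < n (x % t) ⟧ ≡ 0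
abacus-vanishes t K n n≤K x tK≤x = ⟦<⟧-no (≤-trans (n≤K (x % t) (m%n<n x t))
  (subst (_≤ x / t) (m*n/n≡m K t) (/-monoˡ-≤ t (subst (_≤ x) (*-comm t K) tK≤x))))

cores-complementary : ∀ t .{{_ : NonZero t}} K N M λs μs → N + M ≡ t * K →
  Linked _≥_ λs → Linked _≥_ μs → length λs ≤ N → length μs ≤ M → IsCore t λs → IsCore t μs →
  (∀ r r′ → suc (r + r′) ≡ t → residueCount t (part λs) N r + residueCount t (part μs) M r′ ≡ K) →
  ∀ x y → suc (x + y) ≡ N + M → mult (β (part λs) N) N x + mult (β (part μs) M) M y ≡ 1
cores-complementary t K N M λs μs N+M≡tK λs↓ μs↓ ℓλ≤N ℓμ≤M λ-core μ-core counts x y x+y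
  with divMod-complement t K x y (trans x+y N+M≡tK)
... | residues , quotients = begin
  mult (β (part λs) N) N x + mult (β (part μs) M) M y
    ≡⟨ cong₂ _+_ (core-mult t λs N λs↓ ℓλ≤N λ-core x) (core-mult t μs M μs↓ ℓμ≤M μ-core y) ⟩
  ⟦ x / t < residueCount t (part λs) N (x % t) ⟧ + ⟦ y / t < residueCount t (part μs) M (y % t) ⟧
    ≡⟨ ⟦<⟧-complement (residueCount t (part λs) N (x % t)) (residueCount t (part μs) M (y % t)) (x / t) (y / t)
                      (trans quotients (sym (counts (x % t) (y % t) residues))) ⟩
  1 ∎
  where open ≡-Reasoning

nCount-complement⇒residueCount-complement : ∀ t .{{_ : NonZero t}} K N M L L′ →
  (∀ r → r < t → nCount t r L N + nCount t (t ∸ 1 ∸ r) L′ M ≡ K) →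
  ∀ r r′ → suc (r + r′) ≡ t → residueCount t (part L) N r + residueCount t (part L′) M r′ ≡ K
nCount-complement⇒residueCount-complement t K N M L L′ nCounts r r′ r+r′ =
  subst (λ s → residueCount t (part L) N r + residueCount t (part L′) M s ≡ K) r′≡
    (trans (sym (cong₂ _+_ (nCount≡residueCount t r L N) (nCount≡residueCount t (t ∸ 1 ∸ r) L′ M)))
           (nCounts r (subst (r <_) r+r′ (s≤s (m≤m+n r r′)))))
  where
  r′≡ : t ∸ 1 ∸ r ≡ r′
  r′≡ = trans (cong (λ t → t ∸ 1 ∸ r) (sym r+r′)) (m+n∸m≡n r r′)

β-bounded⇒p₁≤ : ∀ p N M → 0 < N → (∀ x → N + M ≤ x → mult (β p N) N x ≡ 0) → p 1 ≤ M
β-bounded⇒p₁≤ p N M N>0 vanishes = +-cancelʳ-≤ N (p 1) M (begin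
  p 1 + N           ≡⟨ cong (p 1 +_) (m+[n∸m]≡n N>0) ⟨
  p 1 + suc (N ∸ 1) ≡⟨ +-suc (p 1) (N ∸ 1) ⟩
  suc (β p N 0)     ≤⟨ β₀<N+M ⟩
  N + M             ≡⟨ +-comm N M ⟩
  M + N             ∎)
  where
  open ≤-Reasoning
  β₀<N+M : β p N 0 < N + M
  β₀<N+M with β p N 0 <? N + M
  ... | yes β₀< = β₀<
  ... | no  β₀≮ = contradiction (sym (vanishes _ (≮⇒≥ β₀≮))) (<⇒≢ (mult-self (β p N) N 0 N>0))

cores-nCount-complement⇒conj : ∀ t .{{_ : NonZero t}} K N M λs μs → N + M ≡ t * K → 0 < N →
  IsPartition λs → IsPartition μs → length λs ≤ N → length μs ≤ M → IsCore t λs → IsCore t μs →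
  (∀ r → r < t → nCount t r λs N + nCount t (t ∸ 1 ∸ r) μs M ≡ K) → μs ≡ conj λs
cores-nCount-complement⇒conj t K N M λs μs N+M≡tK N>0 (λs↓ , _) (μs↓ , μs>0) ℓλ≤N ℓμ≤M
                             λ-core μ-core nCounts =
  part-injective μs (conj λs) μs>0 (conj-positive λs)
    (λ k → trans (parts k) (sym (part-conj λs N λs↓ ℓλ≤N k)))
  where
  p = part λs
  q = part μs
  p↓ = part-weaklyDecreasing λs λs↓
  counts : ∀ r r′ → suc (r + r′) ≡ t → residueCount t p N r + residueCount t q M r′ ≡ K
  counts = nCount-complement⇒residueCount-complement t K N M λs μs nCounts
  vanishesλ : ∀ x → N + M ≤ x → mult (β p N) N x ≡ 0
  vanishesλ x N+M≤x = trans (core-mult t λs N λs↓ ℓλ≤N λ-core x) (abacus-vanishes t K (residueCount t p N)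
    (λ r r<t → m+n≤o⇒m≤o _ (≤-reflexive (counts r (t ∸ 1 ∸ r) (suc-+-∸-suc r<t))))
    x (subst (_≤ x) N+M≡tK N+M≤x))
  vanishesμ : ∀ y → N + M ≤ y → mult (β q M) M y ≡ 0
  vanishesμ y N+M≤y = trans (core-mult t μs M μs↓ ℓμ≤M μ-core y) (abacus-vanishes t K (residueCount t q M)
    (λ s s<t → m+n≤o⇒n≤o _ (≤-reflexive
      (counts (t ∸ 1 ∸ s) s (trans (cong suc (+-comm _ s)) (suc-+-∸-suc s<t)))))
    y (subst (_≤ y) N+M≡tK N+M≤y))
  p≤M : ∀ k → p (suc k) ≤ M
  p≤M k = ≤-trans (part≤part₁ λs λs↓ k) (β-bounded⇒p₁≤ p N M N>0 vanishesλ)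
  sameMult : ∀ y → mult (β q M) M y ≡ mult (β (conjugate p N) M) M y
  sameMult = complement-unique (N + M) (mult (β p N) N) (mult (β q M) M) (mult (β (conjugate p N) M) M)
    (cores-complementary t K N M λs μs N+M≡tK λs↓ μs↓ ℓλ≤N ℓμ≤M λ-core μ-core counts)
    (β-conjugate-complementary N M p p↓ p≤M) vanishesμ (mult-≥ _ M (N + M) (β-conjugate< p N M))
  parts : ∀ k → q (suc k) ≡ conjugate p N (suc k)
  parts k with k <? M
  ... | yes k<M = +-cancelʳ-≡ (M ∸ suc k) _ _ (mult-injective (β q M) (β (conjugate p N) M) M
          (β-strictlyDecreasing q M (part-weaklyDecreasing μs μs↓))
          (β-strictlyDecreasing (conjugate p N) M (conjugate-weaklyDecreasing p N)) sameMult k k<M)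
  ... | no  k≮M = trans (part-≥length μs k (≤-trans ℓμ≤M (≮⇒≥ k≮M)))
          (sym (∑-zero N (λ i _ → ⟦≤⟧-no (s≤s (≤-trans (p≤M i) (≮⇒≥ k≮M))))))

lemma3p2 : (t : ℕ) → .{{_ : NonZero t}} → 2 ≤ t → (m₁ m₂ : ℕ) → 1 ≤ m₁ → 1 ≤ m₂ →
           (λs μs : List ℕ) → IsPartition λs → IsPartition μs →
           ℓ λs ≤ t * m₁ → ℓ μs ≤ t * m₂ →
           (μs ≡ conj λs →
              ∀ i → i < t → nCount t i λs (t * m₁) + nCount t ((t ∸ 1) ∸ i) μs (t * m₂) ≡ m₁ + m₂)
           × (IsCore t λs → IsCore t μs →
              (∀ i → i < t → nCount t i λs (t * m₁) + nCount t ((t ∸ 1) ∸ i) μs (t * m₂) ≡ m₁ + m₂) →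
              μs ≡ conj λs)
-- Only t ≥ 1 (from NonZero t) and m₁ ≥ 1 are used.
lemma3p2 t _ m₁ m₂ m₁≥1 _ λs μs λ-partition μ-partition ℓλ≤N ℓμ≤M =
    (λ { refl → conj-nCount-complement t K N M λs N+M≡tK (proj₁ λ-partition) ℓλ≤N ℓμ≤M })
  , cores-nCount-complement⇒conj t K N M λs μs N+M≡tK N>0 λ-partition μ-partition ℓλ≤N ℓμ≤M
  where
  N = t * m₁
  M = t * m₂
  K = m₁ + m₂
  N+M≡tK : N + M ≡ t * K
  N+M≡tK = sym (*-distribˡ-+ t m₁ m₂)
  N>0 : 0 < N
  N>0 = *-mono-≤ (>-nonZero⁻¹ t) m₁≥1
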